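{- Let $P$ be a non-empty set and $\mathcal{L}$ a set of formulae with semantic function $[\![\cdot]\!]:\mathcal{L}\to\mathcal{P}(P)$ such that $\mathcal{L}(p)\neq\emptyset$ for every $p\in P$. Suppose $\mathcal{L}$ is finitely characterized by $\mathcal{B}$ for some monotonic $\mathcal{B}$. Then for each $\phi\in\mathcal{L}$ and each $q\in[\![\phi]\!]$ there exists $p\in P$ such that $\mathcal{L}(p)\subseteq\mathcal{L}(q)$ and $p$ is minimal in $[\![\phi]\!]$.
   Context: For $p\in P$, $\mathcal{L}(p)=\{\phi\in\mathcal{L}\mid p\in[\![\phi]\!]\}$. For $S\subseteq P$, $p$ is minimal in $S$ iff $p\in S$ and for each $q\in S$, $\mathcal{L}(q)\subseteq\mathcal{L}(p)$ implies $\mathcal{L}(q)=\mathcal{L}(p)$. $\mathcal{L}$ is characterized by $\mathcal{B}:P\to\mathcal{P}(\mathcal{L})$ iff for each $p\in P$: $\emptyset\subsetneq\mathcal{B}(p)\subseteq\mathcal{L}(p)$ and for each $\phi\in\mathcal{L}(p)$, $\bigcap_{\psi\in\mathcal{B}(p)}[\![\psi]\!]\subseteq[\![\phi]\!]$; finitely characterized if moreover each $\mathcal{B}(p)$ is finite. $\mathcal{B}$ is monotonic iff $\mathcal{L}(p)\subseteq\mathcal{L}(q)$ implies $\mathcal{B}(p)\subseteq\mathcal{B}(q)$ for all $p,q\in P$. -}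

module Defs where

open import Data.Product using (Σ; ∃; _×_; _,_)
open import Data.List using (List)
open import Data.List.Membership.Propositional using (_∈_)
open import Relation.Unary using (Pred; _⊆_; _≐_; Satisfiable)
open import Function.Bundles using (_⇔_)
open import Level using (0ℓ)

module Logic {P L : Set} (_⊨_ : P → L → Set) where

  ⟦_⟧ : L → Pred P 0ℓ
  ⟦ φ ⟧ p = p ⊨ φ

  𝓛 : P → Pred L 0ℓ
  𝓛 p φ = p ⊨ φ

  Minimal : Pred P 0ℓ → P → Set
  Minimal S p = S p × (∀ q → S q → 𝓛 q ⊆ 𝓛 p → 𝓛 q ≐ 𝓛 p)

  ⋂⟦_⟧ : Pred L 0ℓ → Pred P 0ℓ
  ⋂⟦ X ⟧ r = ∀ ψ → X ψ → r ⊨ ψ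

  CharacterizedBy : (P → Pred L 0ℓ) → Set
  CharacterizedBy 𝓑 = ∀ p →
      Satisfiable (𝓑 p)
    × 𝓑 p ⊆ 𝓛 p
    × (∀ φ → 𝓛 p φ → ⋂⟦ 𝓑 p ⟧ ⊆ ⟦ φ ⟧)

  FiniteSet : Pred L 0ℓ → Set
  FiniteSet X = Σ (List L) λ xs → ∀ ψ → X ψ ⇔ ψ ∈ xs

  FinitelyCharacterizedBy : (P → Pred L 0ℓ) → Set
  FinitelyCharacterizedBy 𝓑 = CharacterizedBy 𝓑 × (∀ p → FiniteSet (𝓑 p))

  Monotonic : (P → Pred L 0ℓ) → Set
  Monotonic 𝓑 = ∀ p q → 𝓛 p ⊆ 𝓛 q → 𝓑 p ⊆ 𝓑 q

{-# OPTIONS --safe #-}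
-- If 𝓛 r ⊊ 𝓛 p then 𝓑 r ⊊ 𝓑 p: monotonicity gives 𝓑 r ⊆ 𝓑 p, and 𝓑 p ⊆ 𝓑 r
-- would force 𝓛 p ⊆ 𝓛 r, because r satisfies 𝓑 p, which characterizes p.
-- Hence a strict descent inside ⟦φ⟧ starting at q strictly shrinks a finite
-- list covering 𝓑 q, so every descent terminates, and classically a descent
-- that cannot be continued ends in a minimal element of ⟦φ⟧ below q.
module Submission where

open import Defs
open import Data.Product using (Σ; ∃; _×_; _,_; proj₁; proj₂)
open import Data.List using (List; length; filter)
open import Data.List.Properties using (filter-notAll)
open import Data.List.Membership.Propositional using (_∈_; lose)
open import Data.List.Membership.Propositional.Properties using (∈-filter⁺)
open import Data.Nat using (_<_)
open import Data.Nat.Induction using (<-wellFounded)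
open import Function using (id)
open import Function.Bundles using (Equivalence)
open import Induction.WellFounded using (Acc; acc)
open import Relation.Nullary using (¬_; yes; no)
open import Relation.Unary using (Pred; _⊆_; Satisfiable; Decidable)
open import Axiom.ExcludedMiddle using (ExcludedMiddle)
open import Axiom.DoubleNegationElimination using (em⇒dne)
open import Level using (0ℓ)

module _ (em : ExcludedMiddle 0ℓ) {A : Set} where

  ¬⊆⇒∃∖ : {X Y : Pred A 0ℓ} → ¬ (X ⊆ Y) → ∃ λ x → X x × ¬ Y x
  ¬⊆⇒∃∖ X⊈Y = em⇒dne em λ ∄x → X⊈Y λ {x} Xx → em⇒dne em λ ¬Yx → ∄x (x , Xx , ¬Yx)

  ⊂-shrinks-cover : {X Y : Pred A 0ℓ} (xs : List A) → X ⊆ (_∈ xs) → Y ⊆ X → ¬ (X ⊆ Y) →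
                    Σ (List A) λ ys → length ys < length xs × Y ⊆ (_∈ ys)
  ⊂-shrinks-cover {X} {Y} xs X⊆xs Y⊆X X⊈Y =
    let (x , Xx , ¬Yx) = ¬⊆⇒∃∖ X⊈Y
    in filter Y? xs , filter-notAll Y? xs (lose (X⊆xs Xx) ¬Yx) , λ Yy → ∈-filter⁺ Y? (X⊆xs (Y⊆X Yy)) Yy
    where
    Y? : Decidable Y
    Y? _ = em

module _ {P L : Set} (_⊨_ : P → L → Set) where
  open Logic _⊨_

  StrictlyBelowIn : Pred P 0ℓ → P → P → Set
  StrictlyBelowIn S r p = S r × 𝓛 r ⊆ 𝓛 p × ¬ (𝓛 p ⊆ 𝓛 r)

  characterizedBy⇒𝓑-⊆⇒𝓛-⊆ : ∀ {𝓑} → CharacterizedBy 𝓑 →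
                             ∀ {p r} → 𝓑 p ⊆ 𝓑 r → 𝓛 p ⊆ 𝓛 r
  characterizedBy⇒𝓑-⊆⇒𝓛-⊆ char {p} {r} 𝓑p⊆𝓑r {φ} pφ =
    let (_ , _ , 𝓑p-determines) = char p
        (_ , 𝓑r⊆𝓛r , _)         = char r
    in 𝓑p-determines φ pφ λ ψ 𝓑pψ → 𝓑r⊆𝓛r (𝓑p⊆𝓑r 𝓑pψ)

  module Classical (em : ExcludedMiddle 0ℓ) where

    nothing-below⇒minimal : ∀ {S p} → S p → (∀ r → ¬ StrictlyBelowIn S r p) → Minimal S p
    nothing-below⇒minimal Sp nothing-below =
      Sp , λ r Sr 𝓛r⊆𝓛p → 𝓛r⊆𝓛p , em⇒dne em λ 𝓛p⊈𝓛r → nothing-below r (Sr , 𝓛r⊆𝓛p , 𝓛p⊈𝓛r)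

    minimal-below : ∀ {S p} → Acc (StrictlyBelowIn S) p → S p →
                    Σ P λ m → 𝓛 m ⊆ 𝓛 p × Minimal S m
    minimal-below {S} {p} (acc rs) Sp with em {Σ P λ r → StrictlyBelowIn S r p}
    ... | no nothing-below = p , id , nothing-below⇒minimal Sp λ r r<p → nothing-below (r , r<p)
    ... | yes (r , r<p@(Sr , 𝓛r⊆𝓛p , _)) =
      let (m , 𝓛m⊆𝓛r , minimal) = minimal-below (rs r<p) Sr
      in m , (λ mψ → 𝓛r⊆𝓛p (𝓛m⊆𝓛r mψ)) , minimal

    finitely-covered⇒acc : ∀ {𝓑} → CharacterizedBy 𝓑 → Monotonic 𝓑 →
                           ∀ S (xs : List L) p → 𝓑 p ⊆ (_∈ xs) → Acc (StrictlyBelowIn S) p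
    finitely-covered⇒acc {𝓑} char mono S xs = go xs (<-wellFounded (length xs))
      where
      go : ∀ xs → Acc _<_ (length xs) → ∀ p → 𝓑 p ⊆ (_∈ xs) → Acc (StrictlyBelowIn S) p
      go xs (acc shorter) p 𝓑p⊆xs = acc λ {r} (_ , 𝓛r⊆𝓛p , 𝓛p⊈𝓛r) →
        let (ys , ys<xs , 𝓑r⊆ys) =
              ⊂-shrinks-cover em xs 𝓑p⊆xs (mono r p 𝓛r⊆𝓛p)
                λ 𝓑p⊆𝓑r → 𝓛p⊈𝓛r (characterizedBy⇒𝓑-⊆⇒𝓛-⊆ char 𝓑p⊆𝓑r)
        in go ys (shorter ys<xs) r 𝓑r⊆ys

mainTheorem12 : ExcludedMiddle 0ℓ →
    {P L : Set} (_⊨_ : P → L → Set) →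
    P →
    (∀ p → Satisfiable (Logic.𝓛 _⊨_ p)) →
    (𝓑 : P → Pred L 0ℓ) →
    Logic.FinitelyCharacterizedBy _⊨_ 𝓑 →
    Logic.Monotonic _⊨_ 𝓑 →
    ∀ (φ : L) (q : P) → q ⊨ φ →
    Σ P λ p → (Logic.𝓛 _⊨_ p ⊆ Logic.𝓛 _⊨_ q) × Logic.Minimal _⊨_ (Logic.⟦_⟧ _⊨_ φ) p
mainTheorem12 em {L = L} _⊨_ _ _ 𝓑 (char , finite) mono φ q qφ =
  minimal-below (finitely-covered⇒acc char mono (Logic.⟦_⟧ _⊨_ φ) xs q 𝓑q⊆xs) qφ
  where
  open Classical _⊨_ em
  xs : List L
  xs = proj₁ (finite q)
  𝓑q⊆xs : 𝓑 q ⊆ (_∈ xs)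
  𝓑q⊆xs {ψ} = Equivalence.to (proj₂ (finite q) ψ)
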